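{- If $H$ is a contraction minor of a finite simple graph $G$, then $\theta(H)\leq\theta(G)$.
   Context: For a finite simple graph $G$, $\theta(G)$ is defined recursively by: $\theta(G)=0$ if $G$ has no edges, and otherwise $\theta(G)=\min_{v}\max\{\theta(G-v),\ \theta(G-N_G[v])+1\}$, the minimum over non-isolated vertices $v$, where $N_G[v]$ is the closed neighborhood of $v$ (this is the theta-number of the independence complex of $G$). For an edge $e=xy$ of $G$, the contraction $G/e$ is the simple graph with vertex set $(V(G)\setminus\{x,y\})\cup\{w\}$ for a new vertex $w$, and edge set $E(G-\{x,y\})\cup\{wz: z\in N_G(x)\cup N_G(y),\ z\notin\{x,y\}\}$. A graph $H$ is a contraction minor of $G$ if $H$ is obtained from $G$ by a sequence of edge contractions. -}

module Defs where

open import Data.Nat using (ℕ; zero; suc; _⊔_; _⊓_)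
open import Data.Bool using (Bool; true; false; _∧_; _∨_; not; if_then_else_)
open import Data.Fin using (Fin; punchOut)
open import Data.Fin.Properties using (_≟_)
open import Data.List using (List; []; _∷_; filter; map; allFin)
open import Data.Bool.ListAction using (any)
open import Relation.Nullary using (¬_; yes; no)
open import Relation.Nullary.Decidable using (⌊_⌋)
open import Relation.Binary.PropositionalEquality using (_≡_; _≢_)

Graph : ℕ → Set
Graph n = Fin n → Fin n → Bool

record IsSimple {n : ℕ} (G : Graph n) : Set where
  field
    sym     : ∀ u v → G u v ≡ G v u
    irrefl  : ∀ v → G v v ≡ false

anyV : {n : ℕ} → (Fin n → Bool) → Bool
anyV {n} p = any p (allFin n)

VSet : ℕ → Set
VSet n = Fin n → Bool

hasEdge : {n : ℕ} → Graph n → VSet n → Bool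
hasEdge G S = anyV (λ u → anyV (λ v → S u ∧ S v ∧ G u v))

nonIsolated : {n : ℕ} → Graph n → VSet n → Fin n → Bool
nonIsolated G S v = S v ∧ anyV (λ u → S u ∧ G v u)

delV : {n : ℕ} → VSet n → Fin n → VSet n
delV S v u = S u ∧ not ⌊ u ≟ v ⌋

delN : {n : ℕ} → Graph n → VSet n → Fin n → VSet n
delN G S v u = S u ∧ not ⌊ u ≟ v ⌋ ∧ not (G v u)

-- minimum of a list (0 on the empty list; only used on nonempty lists)
minL : List ℕ → ℕ
minL []       = 0
minL (x ∷ []) = x
minL (x ∷ xs@(_ ∷ _)) = x ⊓ minL xs

-- θ of the induced subgraph G[S], with fuel k.  Every recursive call removes
-- at least the vertex v ∈ S, so fuel n (≥ |S|) is always sufficient; when the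
-- fuel runs out S is empty, hence edgeless, and the value 0 is correct.
θ-aux : {n : ℕ} → Graph n → ℕ → VSet n → ℕ
θ-aux G zero    S = 0
θ-aux G (suc k) S with hasEdge G S
... | false = 0
... | true  = minL (map (λ v → θ-aux G k (delV S v) ⊔ suc (θ-aux G k (delN G S v)))
                        (filter (λ v → nonIsolated G S v ≟b true) (allFin _)))
  where
  open import Data.Bool.Properties renaming (_≟_ to _≟b_)

θ : {n : ℕ} → Graph n → ℕ
θ {n} G = θ-aux G n (λ _ → true)

-- Contraction of the edge xy of a graph on Fin (suc m): vertex y is removed,
-- and x plays the role of the new vertex w.
collapse : {m : ℕ} (x y : Fin (suc m)) → x ≢ y → Fin (suc m) → Fin m
collapse x y x≢y v with y ≟ v
... | yes _   = punchOut {i = y} {j = x} (λ e → x≢y (Relation.Binary.PropositionalEquality.sym e))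
... | no y≢v = punchOut y≢v

contract : {m : ℕ} → Graph (suc m) → (x y : Fin (suc m)) → x ≢ y → Graph m
contract G x y x≢y a b =
  not ⌊ a ≟ b ⌋ ∧
  anyV (λ u → anyV (λ v →
    G u v ∧ ⌊ collapse x y x≢y u ≟ a ⌋ ∧ ⌊ collapse x y x≢y v ≟ b ⌋))

data ContractionMinor : {n m : ℕ} → Graph n → Graph m → Set where
  done : {n : ℕ} {G : Graph n} → ContractionMinor G G
  step : {m k : ℕ} {G : Graph (suc m)} {H : Graph k}
         (x y : Fin (suc m)) (x≢y : x ≢ y) → G x y ≡ true →
         ContractionMinor (contract G x y x≢y) H → ContractionMinor G H

-- Write θ(S) for θ of the induced subgraph G[S]; it is the minimum over non-isolated v
-- of max (θ(S − v), θ(S − N[v]) + 1).  By well-founded induction on S, deleting an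
-- isolated vertex does not increase θ, and hence θ is monotone under induced subgraphs.
-- A contraction is the quotient of G by a vertex map c, and θ_quotient(S) ≤ θ_G(c⁻¹ S):
-- take v optimal for c⁻¹ S; if c v is isolated in the quotient it is removed for free,
-- and otherwise c⁻¹ (S − c v) ⊆ c⁻¹ S − v and c⁻¹ (S − N[c v]) ⊆ c⁻¹ S − N[v], because
-- every neighbour of v is mapped to c v or to a neighbour of c v.
module Submission where

open import Defs
open import Data.Nat using (ℕ; zero; suc; _≤_; _<_; _⊔_; z≤n; s≤s)
open import Data.Nat.Properties
  using ( ≤-refl; ≤-trans; ≤-reflexive; <-≤-trans; ≤-pred; n≮0; m≤m⊔n; ⊔-mono-≤
        ; m⊓n≤m; m⊓n≤n; ⊓-sel; module ≤-Reasoning)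
open import Data.Nat.Induction using (<-wellFounded)
open import Data.Bool using (Bool; true; false; T; not; _∧_)
open import Data.Bool.Properties using (T-∧; T-≡; T?) renaming (_≟_ to _≟ᵇ_)
open import Data.Fin using (Fin)
open import Data.Fin.Properties using (_≟_)
import Data.Fin.Subset as Subset
open import Data.Fin.Subset.Properties using (p⊂q⇒∣p∣<∣q∣; ∣p∣≤n)
open import Data.Vec using (tabulate)
open import Data.Vec.Properties using (lookup⇒[]=; []=⇒lookup; lookup∘tabulate)
open import Data.List using (List; []; _∷_; map; filter; allFin)
open import Data.List.Properties using (map-cong-local)
open import Data.List.Membership.Propositional using (_∈_)
open import Data.List.Membership.Propositional.Properties
  using (∈-map⁺; ∈-map⁻; ∈-filter⁺; ∈-filter⁻; ∈-allFin)
open import Data.List.Relation.Unary.Any using (here; there)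
open import Data.List.Relation.Unary.Any.Properties using (any⁺; any⁻; tabulate⁺; tabulate⁻)
import Data.List.Relation.Unary.All as All
open import Data.Product using (∃; ∃₂; _×_; _,_; proj₁; proj₂)
open import Data.Sum using (_⊎_; inj₁; inj₂; [_,_]′)
open import Data.Empty using (⊥-elim)
open import Function using (_∘_; Equivalence)
open import Induction.WellFounded using (WellFounded; Acc; acc; module Subrelation)
import Relation.Binary.Construct.On as On
open import Relation.Nullary using (¬_; Dec; yes; no; contradiction)
open import Relation.Nullary.Decidable
  using (⌊_⌋; map′; fromWitness; toWitness; fromWitnessFalse; toWitnessFalse)
open import Relation.Binary.PropositionalEquality using (_≡_; _≢_; refl; sym; trans; cong; cong₂; subst)

private variable
  n m : ℕ
  a b : Bool

∧-intro : T a → T b → T (a ∧ b)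
∧-intro p q = Equivalence.from T-∧ (p , q)

∧-elim : T (a ∧ b) → T a × T b
∧-elim = Equivalence.to T-∧

T-ext : (T a → T b) → (T b → T a) → a ≡ b
T-ext {false} {false} _ _ = refl
T-ext {false} {true}  _ f = ⊥-elim (f _)
T-ext {true}  {false} f _ = ⊥-elim (f _)
T-ext {true}  {true}  _ _ = refl

not-intro : ¬ T a → T (not a)
not-intro {false} _  = _
not-intro {true}  ¬t = ¬t _

not-elim : T (not a) → ¬ T a
not-elim {false} _ ()

anyV-intro : (p : Fin n → Bool) (u : Fin n) → T (p u) → T (anyV p)
anyV-intro p u pu = any⁺ p (tabulate⁺ u pu)

anyV-elim : (p : Fin n → Bool) → T (anyV p) → ∃ λ u → T (p u)
anyV-elim {n} p t = tabulate⁻ (any⁻ p (allFin n) t)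

minL-≤ : ∀ {x xs} → x ∈ xs → minL xs ≤ x
minL-≤ {xs = _ ∷ []}     (here refl) = ≤-refl
minL-≤ {xs = y ∷ _ ∷ _}  (here refl) = m⊓n≤m y _
minL-≤ {xs = y ∷ z ∷ zs} (there x∈) = ≤-trans (m⊓n≤n y _) (minL-≤ x∈)

minL-∈ : ∀ {x xs} → x ∈ xs → minL xs ∈ xs
minL-∈ {xs = _ ∷ []} _ = here refl
minL-∈ {xs = y ∷ z ∷ zs} _ =
  [ here , (λ eq → there (subst (_∈ z ∷ zs) (sym eq) (minL-∈ (here refl)))) ]′
    (⊓-sel y (minL (z ∷ zs)))

-- A record rather than T (S u), so that S and u can be inferred from a membership proof.
record _∈ᵥ_ (u : Fin n) (S : VSet n) : Set where
  constructor member
  field isMember : T (S u)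

private variable
  S S′ R : VSet n
  u v w : Fin n
  G : Graph n

_⊆_ : VSet n → VSet n → Set
R ⊆ S = ∀ {u} → u ∈ᵥ R → u ∈ᵥ S

_⊂_ : VSet n → VSet n → Set
R ⊂ S = R ⊆ S × ∃ λ v → v ∈ᵥ S × ¬ v ∈ᵥ R

_⊆_∪⁅_⁆ : VSet n → VSet n → Fin n → Set
S ⊆ R ∪⁅ v ⁆ = ∀ {u} → u ∈ᵥ S → u ≢ v → u ∈ᵥ R

size : VSet n → ℕ
size S = Subset.∣ tabulate S ∣

∈-tabulate⁺ : u ∈ᵥ S → u Subset.∈ tabulate S
∈-tabulate⁺ {u = u} {S = S} (member t) =
  lookup⇒[]= u (tabulate S) (trans (lookup∘tabulate S u) (Equivalence.to T-≡ t))

∈-tabulate⁻ : ∀ {S : VSet n} {u} → u Subset.∈ tabulate S → u ∈ᵥ S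
∈-tabulate⁻ {S = S} {u} p =
  member (Equivalence.from T-≡ (trans (sym (lookup∘tabulate S u)) ([]=⇒lookup p)))

⊂⇒size< : R ⊂ S → size R < size S
⊂⇒size< (R⊆S , v , v∈S , v∉R) =
  p⊂q⇒∣p∣<∣q∣ (∈-tabulate⁺ ∘ R⊆S ∘ ∈-tabulate⁻ , v , ∈-tabulate⁺ v∈S , v∉R ∘ ∈-tabulate⁻)

⊂-wellFounded : WellFounded (_⊂_ {n})
⊂-wellFounded = Subrelation.wellFounded ⊂⇒size< (On.wellFounded size <-wellFounded)

delV-intro : u ∈ᵥ S → u ≢ v → u ∈ᵥ delV S v
delV-intro (member su) u≢v = member (∧-intro su (fromWitnessFalse u≢v))

delV-elim : u ∈ᵥ delV S v → u ∈ᵥ S × u ≢ v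
delV-elim (member t) = let su , u≢v = ∧-elim t in member su , toWitnessFalse u≢v

delV-mono : R ⊆ S → delV R v ⊆ delV S v
delV-mono R⊆S u∈ = let u∈R , u≢v = delV-elim u∈ in delV-intro (R⊆S u∈R) u≢v

delV-⊆ : delV S v ⊆ S
delV-⊆ u∈ = proj₁ (delV-elim u∈)

delV-⊂ : v ∈ᵥ S → delV S v ⊂ S
delV-⊂ v∈S = delV-⊆ , _ , v∈S , λ v∈ → proj₂ (delV-elim v∈) refl

module _ (G : Graph n) where

  delN-intro : u ∈ᵥ S → u ≢ v → ¬ T (G v u) → u ∈ᵥ delN G S v
  delN-intro (member su) u≢v ¬vu =
    member (∧-intro su (∧-intro (fromWitnessFalse u≢v) (not-intro ¬vu)))

  delN-elim : u ∈ᵥ delN G S v → u ∈ᵥ S × u ≢ v × ¬ T (G v u)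
  delN-elim (member t) =
    let su , t′ = ∧-elim t ; u≢v , ¬vu = ∧-elim t′
    in member su , toWitnessFalse u≢v , not-elim ¬vu

  delN-mono : R ⊆ S → delN G R v ⊆ delN G S v
  delN-mono R⊆S u∈ = let u∈R , u≢v , ¬vu = delN-elim u∈ in delN-intro (R⊆S u∈R) u≢v ¬vu

  delN-⊆ : delN G S v ⊆ S
  delN-⊆ {S = S} u∈ = proj₁ (delN-elim {S = S} u∈)

  delN-⊂ : v ∈ᵥ S → delN G S v ⊂ S
  delN-⊂ {S = S} v∈S = delN-⊆ , _ , v∈S , λ v∈ → proj₁ (proj₂ (delN-elim {S = S} v∈)) refl

∈-preimage⁺ : ∀ {S : VSet m} (c : Fin n → Fin m) {u} → c u ∈ᵥ S → u ∈ᵥ (S ∘ c)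
∈-preimage⁺ _ (member t) = member t

∈-preimage⁻ : ∀ {S : VSet m} (c : Fin n → Fin m) {u} → u ∈ᵥ (S ∘ c) → c u ∈ᵥ S
∈-preimage⁻ _ (member t) = member t

Symmetric : Graph n → Set
Symmetric G = ∀ u v → G u v ≡ G v u

adjacent-sym : Symmetric G → T (G u v) → T (G v u)
adjacent-sym {u = u} {v = v} G-sym = subst T (G-sym u v)

record NonIsolated (G : Graph n) (S : VSet n) (v : Fin n) : Set where
  constructor withNeighbour
  field
    inSet          : v ∈ᵥ S
    neighbour      : Fin n
    neighbourInSet : neighbour ∈ᵥ S
    adjacent       : T (G v neighbour)
open NonIsolated

Edgeless : Graph n → VSet n → Set
Edgeless G S = ∀ {v} → ¬ NonIsolated G S v

nonIsolated-mono : R ⊆ S → NonIsolated G R v → NonIsolated G S v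
nonIsolated-mono R⊆S (withNeighbour v∈R w w∈R vw) = withNeighbour (R⊆S v∈R) w (R⊆S w∈R) vw

nonIsolated⁺ : NonIsolated G S v → T (nonIsolated G S v)
nonIsolated⁺ (withNeighbour (member sv) w (member sw) vw) = ∧-intro sv (anyV-intro _ w (∧-intro sw vw))

nonIsolated⁻ : ∀ G (S : VSet n) v → T (nonIsolated G S v) → NonIsolated G S v
nonIsolated⁻ G S v t =
  let sv , t′ = ∧-elim t ; w , t″ = anyV-elim _ t′ ; sw , vw = ∧-elim t″
  in withNeighbour (member sv) w (member sw) vw

nonIsolated? : ∀ G (S : VSet n) v → Dec (NonIsolated G S v)
nonIsolated? G S v = map′ (nonIsolated⁻ G S v) nonIsolated⁺ (T? (nonIsolated G S v))

nonIsolated⇒hasEdge : NonIsolated G S v → T (hasEdge G S)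
nonIsolated⇒hasEdge {v = v} (withNeighbour (member sv) w (member sw) vw) =
  anyV-intro _ v (anyV-intro _ w (∧-intro sv (∧-intro sw vw)))

hasEdge⇒nonIsolated : ∀ G (S : VSet n) → T (hasEdge G S) → ∃ (NonIsolated G S)
hasEdge⇒nonIsolated G S t =
  let u , t′ = anyV-elim _ t ; v , t″ = anyV-elim _ t′ ; su , t‴ = ∧-elim t″ ; sv , uv = ∧-elim t‴
  in u , withNeighbour (member su) v (member sv) uv

edgeless-or-nonIsolated : ∀ G (S : VSet n) → Edgeless G S ⊎ ∃ (NonIsolated G S)
edgeless-or-nonIsolated G S with T? (hasEdge G S)
... | yes e = inj₂ (hasEdge⇒nonIsolated G S e)
... | no ¬e = inj₁ (¬e ∘ nonIsolated⇒hasEdge)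

θ[_] : Graph n → VSet n → ℕ
θ[_] {n} G S = θ-aux G n S

branch : Graph n → VSet n → Fin n → ℕ
branch G S v = θ[ G ] (delV S v) ⊔ suc (θ[ G ] (delN G S v))

nonIsolatedVertices : Graph n → VSet n → List (Fin n)
nonIsolatedVertices G S = filter (λ v → nonIsolated G S v ≟ᵇ true) (allFin _)

∈-nonIsolatedVertices⁺ : NonIsolated G S v → v ∈ nonIsolatedVertices G S
∈-nonIsolatedVertices⁺ {G = G} {S = S} ni =
  ∈-filter⁺ (λ v → nonIsolated G S v ≟ᵇ true) (∈-allFin _) (Equivalence.to T-≡ (nonIsolated⁺ ni))

∈-nonIsolatedVertices⁻ : v ∈ nonIsolatedVertices G S → NonIsolated G S v
∈-nonIsolatedVertices⁻ {v = v} {G = G} {S = S} v∈ =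
  nonIsolated⁻ G S v (Equivalence.from T-≡
    (proj₂ (∈-filter⁻ (λ v → nonIsolated G S v ≟ᵇ true) {xs = allFin _} v∈)))

module _ (G : Graph n) where
  private
    branchAt : ℕ → VSet n → Fin n → ℕ
    branchAt k S v = θ-aux G k (delV S v) ⊔ suc (θ-aux G k (delN G S v))

  θ-aux-suc : ∀ k S → size S ≤ k → θ-aux G (suc k) S ≡ θ-aux G k S
  branchAt-suc : ∀ k {S v} → size S ≤ suc k → v ∈ᵥ S → branchAt (suc k) S v ≡ branchAt k S v

  θ-aux-suc zero S size≤0 with hasEdge G S | hasEdge⇒nonIsolated G S
  ... | false | _    = refl
  ... | true  | edge =
    contradiction (<-≤-trans (⊂⇒size< (delV-⊂ (inSet (proj₂ (edge _))))) size≤0) n≮0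
  θ-aux-suc (suc k) S bound with hasEdge G S
  ... | false = refl
  ... | true  = cong minL (map-cong-local (All.tabulate λ v∈ →
                  branchAt-suc k bound (inSet (∈-nonIsolatedVertices⁻ v∈))))

  branchAt-suc k bound v∈S =
    cong₂ _⊔_ (θ-aux-suc k _ (≤-pred (<-≤-trans (⊂⇒size< (delV-⊂ v∈S)) bound)))
              (cong suc (θ-aux-suc k _ (≤-pred (<-≤-trans (⊂⇒size< (delN-⊂ G v∈S)) bound))))

θ-unfold : ∀ {n} {G : Graph n} {S u} → NonIsolated G S u →
           θ[ G ] S ≡ minL (map (branch G S) (nonIsolatedVertices G S))
θ-unfold {n = zero} {u = ()}
θ-unfold {n = suc n} {G = G} {S = S} ni with hasEdge G S | nonIsolated⇒hasEdge ni
... | true | _ = cong minL (map-cong-local (All.tabulate λ v∈ →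
  sym (branchAt-suc G n (∣p∣≤n (tabulate S)) (inSet (∈-nonIsolatedVertices⁻ {G = G} {S = S} v∈)))))

θ-≤-branch : NonIsolated G S v → θ[ G ] S ≤ branch G S v
θ-≤-branch {G = G} {S = S} ni =
  ≤-trans (≤-reflexive (θ-unfold ni)) (minL-≤ (∈-map⁺ (branch G S) (∈-nonIsolatedVertices⁺ ni)))

θ-attained : NonIsolated G S u → ∃ λ v → NonIsolated G S v × θ[ G ] S ≡ branch G S v
θ-attained {G = G} {S = S} ni
  with ∈-map⁻ (branch G S) (minL-∈ (∈-map⁺ (branch G S) (∈-nonIsolatedVertices⁺ ni)))
... | v , v∈ , min≡ = v , ∈-nonIsolatedVertices⁻ v∈ , trans (θ-unfold ni) min≡

θ-edgeless : ∀ {n} {G : Graph n} {S} → Edgeless G S → θ[ G ] S ≡ 0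
θ-edgeless {n = zero} _ = refl
θ-edgeless {n = suc n} {G = G} {S = S} edgeless with hasEdge G S | hasEdge⇒nonIsolated G S
... | false | _    = refl
... | true  | edge = ⊥-elim (edgeless (proj₂ (edge _)))

θ-remove-isolated : Symmetric G → ¬ NonIsolated G S v → R ⊆ S → S ⊆ R ∪⁅ v ⁆ →
                    θ[ G ] S ≤ θ[ G ] R
θ-remove-isolated {G = G} G-sym = go (⊂-wellFounded _)
  where
  go : ∀ {S R v} → Acc _⊂_ S → ¬ NonIsolated G S v → R ⊆ S → S ⊆ R ∪⁅ v ⁆ →
       θ[ G ] S ≤ θ[ G ] R
  go {S} {R} {v} (acc rs) v-isolated R⊆S S⊆R+v with edgeless-or-nonIsolated G R
  ... | inj₁ R-edgeless = ≤-trans (≤-reflexive (θ-edgeless S-edgeless)) z≤n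
    where
    S-edgeless : Edgeless G S
    S-edgeless {u} (withNeighbour u∈S w w∈S uw) =
      R-edgeless (withNeighbour (S⊆R+v u∈S u≢v) w (S⊆R+v w∈S w≢v) uw)
      where
      u≢v : u ≢ v
      u≢v refl = v-isolated (withNeighbour u∈S w w∈S uw)
      w≢v : w ≢ v
      w≢v refl = v-isolated (withNeighbour w∈S _ u∈S (adjacent-sym G-sym uw))
  ... | inj₂ (_ , ni) with θ-attained ni
  ... | u , u-ni , θR≡ = begin
    θ[ G ] S      ≤⟨ θ-≤-branch (nonIsolated-mono R⊆S u-ni) ⟩
    branch G S u  ≤⟨ ⊔-mono-≤ θ-delV (s≤s θ-delN) ⟩
    branch G R u  ≡⟨ sym θR≡ ⟩
    θ[ G ] R      ∎
    where
    open ≤-Reasoning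
    u∈S = R⊆S (inSet u-ni)
    θ-delV : θ[ G ] (delV S u) ≤ θ[ G ] (delV R u)
    θ-delV = go (rs (delV-⊂ u∈S))
      (v-isolated ∘ nonIsolated-mono delV-⊆)
      (delV-mono R⊆S)
      (λ x∈ x≢v → let x∈S , x≢u = delV-elim x∈
                  in delV-intro (S⊆R+v x∈S x≢v) x≢u)
    θ-delN : θ[ G ] (delN G S u) ≤ θ[ G ] (delN G R u)
    θ-delN = go (rs (delN-⊂ G u∈S))
      (v-isolated ∘ nonIsolated-mono (delN-⊆ G))
      (delN-mono G R⊆S)
      (λ x∈ x≢v → let x∈S , x≢u , ¬ux = delN-elim G {S = S} x∈
                  in delN-intro G (S⊆R+v x∈S x≢v) x≢u ¬ux)

θ-mono : Symmetric G → S′ ⊆ S → θ[ G ] S′ ≤ θ[ G ] S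
θ-mono {G = G} G-sym S′⊆S = go (⊂-wellFounded _) S′⊆S
  where
  go : ∀ {S′ S} → Acc _⊂_ S → S′ ⊆ S → θ[ G ] S′ ≤ θ[ G ] S
  go {S′} {S} (acc rs) S′⊆S with edgeless-or-nonIsolated G S′
  ... | inj₁ edgeless = ≤-trans (≤-reflexive (θ-edgeless edgeless)) z≤n
  ... | inj₂ (_ , ni) with θ-attained (nonIsolated-mono S′⊆S ni)
  ... | v , v-ni , θS≡ = ≤-trans θS′≤branch (≤-reflexive (sym θS≡))
    where
    v∈S = inSet v-ni
    θ-delV : θ[ G ] (delV S′ v) ≤ θ[ G ] (delV S v)
    θ-delV = go (rs (delV-⊂ v∈S)) (delV-mono S′⊆S)
    θS′≤branch : θ[ G ] S′ ≤ branch G S v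
    θS′≤branch with nonIsolated? G S′ v
    ... | yes v-ni′ = ≤-trans (θ-≤-branch v-ni′)
            (⊔-mono-≤ θ-delV (s≤s (go (rs (delN-⊂ G v∈S)) (delN-mono G S′⊆S))))
    ... | no v-isolated = ≤-trans (θ-remove-isolated G-sym v-isolated delV-⊆ delV-intro)
                            (≤-trans θ-delV (m≤m⊔n _ _))

quotient : Graph n → (Fin n → Fin m) → Graph m
quotient G c a b = not ⌊ a ≟ b ⌋ ∧ anyV (λ u → anyV (λ v → G u v ∧ ⌊ c u ≟ a ⌋ ∧ ⌊ c v ≟ b ⌋))

module _ {G : Graph n} (c : Fin n → Fin m) where

  quotient-intro : T (G u v) → c u ≢ c v → T (quotient G c (c u) (c v))
  quotient-intro {u = u} {v = v} uv cu≢cv =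
    ∧-intro (fromWitnessFalse cu≢cv)
      (anyV-intro _ u (anyV-intro _ v (∧-intro uv
        (∧-intro (fromWitness {a? = c u ≟ c u} refl) (fromWitness {a? = c v ≟ c v} refl)))))

  quotient-elim : ∀ a b → T (quotient G c a b) →
                  a ≢ b × ∃₂ λ u v → T (G u v) × c u ≡ a × c v ≡ b
  quotient-elim a b t =
    let a≢b , t₁ = ∧-elim t ; u , t₂ = anyV-elim _ t₁ ; v , t₃ = anyV-elim _ t₂
        uv , t₄ = ∧-elim {a = G u v} t₃ ; cu≡a , cv≡b = ∧-elim {a = ⌊ c u ≟ a ⌋} t₄
    in toWitnessFalse a≢b , u , v , uv , toWitness cu≡a , toWitness cv≡b

  quotient-symmetric : Symmetric G → Symmetric (quotient G c)
  quotient-symmetric G-sym a b = T-ext (flip-edge a b) (flip-edge b a)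
    where
    flip-edge : ∀ a b → T (quotient G c a b) → T (quotient G c b a)
    flip-edge a b t with quotient-elim a b t
    ... | a≢b , u , v , uv , refl , refl = quotient-intro (adjacent-sym G-sym uv) (a≢b ∘ sym)

  θ-quotient : Symmetric G → (S : VSet m) → θ[ quotient G c ] S ≤ θ[ G ] (S ∘ c)
  θ-quotient G-sym S = go (⊂-wellFounded S)
    where
    H = quotient G c

    preimage-delV : ∀ {S v} → (delV S (c v) ∘ c) ⊆ delV (S ∘ c) v
    preimage-delV {S} {v} {u} u∈ =
      let cu∈S , cu≢cv = delV-elim {v = c v} (∈-preimage⁻ {S = delV S (c v)} c u∈)
      in delV-intro (∈-preimage⁺ c cu∈S) (cu≢cv ∘ cong c)

    preimage-delN : ∀ {S v} → (delN H S (c v) ∘ c) ⊆ delN G (S ∘ c) v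
    preimage-delN {S} {v} {u} u∈ =
      let cu∈S , cu≢cv , ¬cvcu = delN-elim H {S = S} (∈-preimage⁻ {S = delN H S (c v)} c u∈)
      in delN-intro G (∈-preimage⁺ c cu∈S) (cu≢cv ∘ cong c)
           (λ vu → ¬cvcu (quotient-intro vu (cu≢cv ∘ sym)))

    go : ∀ {S} → Acc _⊂_ S → θ[ H ] S ≤ θ[ G ] (S ∘ c)
    go {S} (acc rs) with edgeless-or-nonIsolated H S
    ... | inj₁ edgeless = ≤-trans (≤-reflexive (θ-edgeless edgeless)) z≤n
    ... | inj₂ (a , withNeighbour a∈S b b∈S ab) with quotient-elim a b ab
    ... | _ , p , q , pq , refl , refl
          with θ-attained (withNeighbour {G = G} (∈-preimage⁺ c a∈S) q (∈-preimage⁺ c b∈S) pq)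
    ... | v , v-ni , θ≡ = ≤-trans θH≤branch (≤-reflexive (sym θ≡))
      where
      cv∈S : c v ∈ᵥ S
      cv∈S = ∈-preimage⁻ c (inSet v-ni)
      θ-delV : θ[ H ] (delV S (c v)) ≤ θ[ G ] (delV (S ∘ c) v)
      θ-delV = ≤-trans (go (rs (delV-⊂ cv∈S))) (θ-mono G-sym (preimage-delV {S = S} {v = v}))
      θH≤branch : θ[ H ] S ≤ branch G (S ∘ c) v
      θH≤branch with nonIsolated? H S (c v)
      ... | yes cv-ni = ≤-trans (θ-≤-branch cv-ni) (⊔-mono-≤ θ-delV (s≤s θ-delN))
        where
        θ-delN : θ[ H ] (delN H S (c v)) ≤ θ[ G ] (delN G (S ∘ c) v)
        θ-delN = ≤-trans (go (rs (delN-⊂ H cv∈S))) (θ-mono G-sym (preimage-delN {S = S} {v = v}))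
      ... | no cv-isolated = ≤-trans (θ-remove-isolated (quotient-symmetric G-sym) cv-isolated
                                        delV-⊆ delV-intro)
                               (≤-trans θ-delV (m≤m⊔n _ _))

θ-contractionMinor : {H : Graph m} → Symmetric G → ContractionMinor G H → θ H ≤ θ G
θ-contractionMinor _ done = ≤-refl
-- contract G x y x≢y is definitionally quotient G (collapse x y x≢y).
θ-contractionMinor G-sym (step x y x≢y _ minor) =
  ≤-trans (θ-contractionMinor (quotient-symmetric (collapse x y x≢y) G-sym) minor)
          (θ-quotient (collapse x y x≢y) G-sym (λ _ → true))

theorem31 : {n m : ℕ} (G : Graph n) (H : Graph m) →
    IsSimple G → ContractionMinor G H → θ H ≤ θ G
theorem31 G H simple minor = θ-contractionMinor (IsSimple.sym simple) minor
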